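{- Let $G$ be a finite simple graph on $n$ vertices with no ds-completable vertex, and let $i, j$ be disjoint vertex sets. Suppose $\chi_{ij}\,\mu_i = m_i$. Let $g = i \setminus B$ and $s = j \setminus \{u : d_u = n - n_i\}$. Then $\epsilon(g,s) = m_g$.
   Context: $V$ is the vertex set, $d_x$ the degree of $x$; for a vertex set $k$, $n_k = |k|$, $m_k = \sum_{x \in k} d_x$, $\bar{k} = V\setminus k$. $\chi_{ij} = m_j - (n-1-n_i)n_j$. $\mu_i = 1$ if $\bar{i}$ is neighbourly and $0$ otherwise, where a set $K$ is neighbourly if $\{d_u : u \notin K\} \cap \{d_u - 1 : u \in K\} = \emptyset$. A vertex is bad if $G$ contains a vertex of degree one less than its degree; $B$ is the set of bad vertices. A vertex $v$ is ds-completable if, for each integer $d$, the vertices having degree $d$ in $G-v$ are either all neighbours of $v$ in $G$ or all non-neighbours. $\epsilon(a,b) = \sum_{x \in a} |N(x) \cap b|$. -}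

module Defs where

open import Data.Bool using (Bool; true; false; if_then_else_; _∧_; not)
open import Data.Nat using (ℕ; _+_; _*_; _∸_; _≟_)
open import Data.Integer as ℤ using (ℤ; +_)
open import Data.Fin using (Fin) renaming (_≟_ to _≟ᶠ_)
open import Data.Fin.Subset using (Subset; ∣_∣; _∩_; _─_; ∁; _∈_; _∉_)
open import Data.Fin.Properties using (any?; all?)
open import Data.Vec using (tabulate; lookup)
open import Data.Vec as Vec using ()
open import Data.Product using (∃)
open import Data.Sum using (_⊎_)
open import Relation.Binary.PropositionalEquality using (_≡_)
open import Relation.Nullary using (¬_; Dec)
open import Relation.Nullary.Decidable using (⌊_⌋; ¬?; _→-dec_)
open import Data.Fin.Subset.Properties using (_∈?_)

record Graph (n : ℕ) : Set where
  field
    adj   : Fin n → Fin n → Bool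
    sym   : ∀ x y → adj x y ≡ adj y x
    irrefl : ∀ x → adj x x ≡ false
open Graph public

module _ {n : ℕ} (G : Graph n) where

  N : Fin n → Subset n
  N x = tabulate (adj G x)

  deg : Fin n → ℕ
  deg x = ∣ N x ∣

  msum : Subset n → ℕ
  msum k = Vec.sum (tabulate λ x → if lookup k x then deg x else 0)

  χ : Subset n → Subset n → ℤ
  χ i j = + msum j ℤ.- ((+ n ℤ.- + 1 ℤ.- + ∣ i ∣) ℤ.* + ∣ j ∣)

  -- K neighbourly: {d_u : u ∉ K} ∩ {d_w - 1 : w ∈ K} = ∅,
  -- i.e. no u ∉ K, w ∈ K with d_u + 1 = d_w
  Neighbourly : Subset n → Set
  Neighbourly K = ∀ u w → u ∉ K → w ∈ K → ¬ (deg u + 1 ≡ deg w)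

  neighbourly? : (K : Subset n) → Dec (Neighbourly K)
  neighbourly? K = all? λ u → all? λ w →
    (¬? (u ∈? K)) →-dec ((w ∈? K) →-dec ¬? (deg u + 1 ≟ deg w))

  μ : Subset n → ℤ
  μ i = if ⌊ neighbourly? (∁ i) ⌋ then + 1 else + 0

  Bad : Fin n → Set
  Bad v = ∃ λ w → deg w + 1 ≡ deg v

  B : Subset n
  B = tabulate λ v → ⌊ any? (λ w → deg w + 1 ≟ deg v) ⌋

  degEq : ℕ → Subset n
  degEq c = tabulate λ u → ⌊ deg u ≟ c ⌋

  -- degree of u in G - v (u ≠ v)
  degMinus : Fin n → Fin n → ℕ
  degMinus v u = ∣ tabulate (λ w → adj G u w ∧ not ⌊ w ≟ᶠ v ⌋) ∣

  DsCompletable : Fin n → Set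
  DsCompletable v = ∀ (d : ℕ) →
      (∀ u → ¬ (u ≡ v) → degMinus v u ≡ d → adj G v u ≡ true)
    ⊎ (∀ u → ¬ (u ≡ v) → degMinus v u ≡ d → adj G v u ≡ false)

  ε : Subset n → Subset n → ℕ
  ε a b = Vec.sum (tabulate λ x → if lookup a x then ∣ N x ∩ b ∣ else 0)

module Submission where

open import Defs
open import Data.Nat using (ℕ; _∸_)
open import Data.Integer using (+_; _*_)
open import Data.Fin using (Fin)
open import Data.Fin.Subset using (Subset; ∣_∣; _─_; Empty; _∩_; ⊥)
open import Relation.Binary.PropositionalEquality using (_≡_)
open import Relation.Nullary using (¬_)

open import Data.Bool using (Bool; true; false; not; _∧_; if_then_else_)
import Data.Bool as Bool
open import Data.Product as Product using (_×_; _,_; proj₁; proj₂)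
open import Data.Bool.Properties using (∧-identityʳ; ∧-zeroʳ; ¬-not)
open import Data.Fin using (zero; suc; _≟_; punchIn)
open import Data.Fin.Properties using (any?; punchInᵢ≢i)
open import Data.Fin.Subset using (∁; _∈_; _∉_; _⊆_)
open import Data.Fin.Subset.Properties
  using (∉⊥; drop-there; _∈?_; x∈p∩q⁺; p∩q⊆p; ⊆-antisym; x∉p⇒x∈∁p; x∈p⇒x∉∁p; x∈p∧x∉q⇒x∈p─q;
         ∣p∣≤n; ∣∁p∣≡n∸∣p∣)
import Data.Integer as ℤ
import Data.Integer.Properties as ℤ
open import Data.Integer.Tactic.RingSolver using (solve-∀)
import Data.Nat as ℕ
open import Data.Nat using (zero; suc; _+_; _≤_; _<_; z≤n; s≤s)
open import Data.Nat.Properties hiding (_≟_)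
open import Algebra.Properties.CommutativeMonoid.Sum +-0-commutativeMonoid
  using (sum; sum-syntax; sum-cong-≗; sum-remove; sum-replicate-zero; ∑-distrib-+; ∑-comm)
open import Data.Sum using (inj₁; inj₂; _⊎_)
open import Data.Vec as Vec using ([]; _∷_; lookup; tabulate; here; there)
open import Data.Vec.Properties
  using (lookup∘tabulate; lookup-map; tabulate-cong; []=⇒lookup; lookup⇒[]=)
open import Data.Vec.Functional using (updateAt)
open import Data.Vec.Functional.Properties using (updateAt-updates; updateAt-minimal)
open import Function using (_∘_)
open import Relation.Binary.PropositionalEquality
  using (refl; trans; cong; cong₂; subst; subst₂; _≢_; module ≡-Reasoning)
import Relation.Binary.PropositionalEquality as ≡
open import Relation.Nullary using (yes; no; contradiction)
open import Relation.Nullary.Decidable using (⌊_⌋; ¬?; _×-dec_; dec-true; dec-false; isYes≗does)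

-- Put t = |∁ i| = n - n_i and split the degree of each y ∈ j into its numbers
-- of neighbours inside and outside i.  As y ∉ i, it has at most t - 1 neighbours outside i,
-- and double counting gives  ∑_{y ∈ j} |N(y) ∩ i| = ∑_{x ∈ i} |N(x) ∩ j| ≤ m_i;  hence
-- m_j + n_j ≤ m_i + t n_j.  If μ_i = 0 the hypothesis says m_i = 0, so i consists of isolated
-- vertices.  Otherwise ∁ i is neighbourly and χ_ij = m_i is exactly  m_j + n_j = m_i + t n_j,
-- so both estimates are tight: every neighbour of a vertex of i lies in j, and every y ∈ j
-- is adjacent to all other vertices outside i.  A neighbour y ∈ j of some x ∈ i ∖ B with
-- d_y = t then has x as its only neighbour in i, and the neighbourliness of ∁ i together with
-- x ∉ B make y ds-completable, which is excluded.  So N(x) ⊆ s for every x ∈ g, and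
-- ε(g, s) = m_g holds summand by summand.

ind : Bool → ℕ
ind b = if b then 1 else 0

restrict : ∀ {n} → Subset n → (Fin n → ℕ) → Fin n → ℕ
restrict k f x = if lookup k x then f x else 0

sumOver : ∀ {n} → Subset n → (Fin n → ℕ) → ℕ
sumOver k f = sum (restrict k f)

syntax sumOver k (λ x → e) = ∑[ x ∈ k ] e

sum-tabulate : ∀ {n} (f : Fin n → ℕ) → Vec.sum (tabulate f) ≡ sum f
sum-tabulate {zero} f = refl
sum-tabulate {suc n} f = cong (λ t → f zero + t) (sum-tabulate (f ∘ suc))

∑-mono : ∀ {n} {f g : Fin n → ℕ} → (∀ x → f x ≤ g x) → sum f ≤ sum g
∑-mono {zero} f≤g = z≤n
∑-mono {suc n} f≤g = +-mono-≤ (f≤g zero) (∑-mono (f≤g ∘ suc))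

∑-strict : ∀ {n} {f g : Fin n → ℕ} → (∀ x → f x ≤ g x) →
           ∀ a → f a < g a → suc (sum f) ≤ sum g
∑-strict {suc n} f≤g zero fa<ga = +-mono-≤ fa<ga (∑-mono (f≤g ∘ suc))
∑-strict {suc n} {f} f≤g (suc a) fa<ga =
  ≤-trans (≤-reflexive (≡.sym (+-suc (f zero) _)))
          (+-mono-≤ (f≤g zero) (∑-strict (f≤g ∘ suc) a fa<ga))

-- Two distinct strictly increasing summands: pass through the function
-- that agrees with g at a and with f elsewhere.
∑-strict₂ : ∀ {n} {f g : Fin n → ℕ} → (∀ x → f x ≤ g x) →
            ∀ {a b} → a ≢ b → f a < g a → f b < g b → 2 + sum f ≤ sum g
∑-strict₂ {n} {f} {g} f≤g {a} {b} a≢b fa<ga fb<gb =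
  ≤-trans (s≤s (∑-strict f≤h a (subst (f a <_) (≡.sym h-at-a) fa<ga)))
          (∑-strict h≤g b (subst (_< g b) (≡.sym (h-off b (a≢b ∘ ≡.sym))) fb<gb))
  where
  h : Fin n → ℕ
  h = updateAt f a (λ _ → g a)
  h-at-a : h a ≡ g a
  h-at-a = updateAt-updates a f
  h-off : ∀ x → x ≢ a → h x ≡ f x
  h-off x x≢a = updateAt-minimal x a f x≢a
  f≤h : ∀ x → f x ≤ h x
  f≤h x with x ≟ a
  ... | yes refl = subst (f x ≤_) (≡.sym h-at-a) (f≤g x)
  ... | no x≢a = ≤-reflexive (≡.sym (h-off x x≢a))
  h≤g : ∀ x → h x ≤ g x
  h≤g x with x ≟ a
  ... | yes refl = ≤-reflexive h-at-a
  ... | no x≢a = subst (_≤ g x) (≡.sym (h-off x x≢a)) (f≤g x)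

∑-tight : ∀ {n} {f g : Fin n → ℕ} → (∀ x → f x ≤ g x) → sum g ≤ sum f →
          ∀ x → f x ≡ g x
∑-tight f≤g ∑g≤∑f x with m≤n⇒m<n∨m≡n (f≤g x)
... | inj₂ fx≡gx = fx≡gx
... | inj₁ fx<gx = contradiction (∑-strict f≤g x fx<gx) (<⇒≱ (s≤s ∑g≤∑f))

∑≡0⇒0 : ∀ {n} {f : Fin n → ℕ} → sum f ≡ 0 → ∀ x → f x ≡ 0
∑≡0⇒0 {suc n} {f} ∑f≡0 zero = m+n≡0⇒m≡0 (f zero) ∑f≡0
∑≡0⇒0 {suc n} {f} ∑f≡0 (suc x) = ∑≡0⇒0 (m+n≡0⇒n≡0 (f zero) ∑f≡0) x

∑-agree-off : ∀ {n} (f g : Fin n → ℕ) a → (∀ x → x ≢ a → f x ≡ g x) →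
              f a + sum g ≡ g a + sum f
∑-agree-off {suc n} f g a agree = begin
  f a + sum g                                ≡⟨ cong (λ t → f a + t) (sum-remove g) ⟩
  f a + (g a + sum (g ∘ punchIn a))          ≡⟨ ≡.sym (+-assoc (f a) (g a) _) ⟩
  f a + g a + sum (g ∘ punchIn a)            ≡⟨ cong (λ t → t + sum (g ∘ punchIn a)) (+-comm (f a) (g a)) ⟩
  g a + f a + sum (g ∘ punchIn a)            ≡⟨ +-assoc (g a) (f a) _ ⟩
  g a + (f a + sum (g ∘ punchIn a))          ≡⟨ cong (λ t → g a + (f a + t)) (sum-cong-≗ off) ⟨
  g a + (f a + sum (f ∘ punchIn a))          ≡⟨ cong (λ t → g a + t) (sum-remove f) ⟨
  g a + sum f                                ∎
  where
  open ≡-Reasoning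
  off : ∀ x → f (punchIn a x) ≡ g (punchIn a x)
  off x = agree (punchIn a x) (punchInᵢ≢i a x)

restrict-∈ : ∀ {n} {k : Subset n} {x} (f : Fin n → ℕ) → x ∈ k → restrict k f x ≡ f x
restrict-∈ {k = k} {x} f x∈k rewrite []=⇒lookup x∈k = refl

restrict-≤ : ∀ {n} {k : Subset n} {f g : Fin n → ℕ} →
             (∀ x → x ∈ k → f x ≤ g x) → ∀ x → restrict k f x ≤ restrict k g x
restrict-≤ {k = k} f≤g x with lookup k x in k[x]
... | true = f≤g x (lookup⇒[]= x k k[x])
... | false = z≤n

∑∈-mono : ∀ {n} {k : Subset n} {f g : Fin n → ℕ} →
          (∀ x → x ∈ k → f x ≤ g x) → sumOver k f ≤ sumOver k g
∑∈-mono f≤g = ∑-mono (restrict-≤ f≤g)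

∑∈-cong : ∀ {n} (k : Subset n) {f g : Fin n → ℕ} → (∀ x → f x ≡ g x) → sumOver k f ≡ sumOver k g
∑∈-cong k f≡g = sum-cong-≗ (λ x → cong (λ t → if lookup k x then t else 0) (f≡g x))

∑∈-strict : ∀ {n} {k : Subset n} {f g : Fin n → ℕ} → (∀ x → x ∈ k → f x ≤ g x) →
            ∀ {a} → a ∈ k → f a < g a → suc (sumOver k f) ≤ sumOver k g
∑∈-strict {f = f} {g} f≤g {a} a∈k fa<ga =
  ∑-strict (restrict-≤ f≤g) a (subst₂ _<_ (≡.sym (restrict-∈ f a∈k)) (≡.sym (restrict-∈ g a∈k)) fa<ga)

∑∈-strict₂ : ∀ {n} {k : Subset n} {f g : Fin n → ℕ} → (∀ x → x ∈ k → f x ≤ g x) →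
             ∀ {a b} → a ∈ k → b ∈ k → a ≢ b → f a < g a → f b < g b →
             2 + sumOver k f ≤ sumOver k g
∑∈-strict₂ {k = k} {f} {g} f≤g a∈k b∈k a≢b fa<ga fb<gb =
  ∑-strict₂ (restrict-≤ f≤g) a≢b (restricted a∈k fa<ga) (restricted b∈k fb<gb)
  where
  restricted : ∀ {x} → x ∈ k → f x < g x → restrict k f x < restrict k g x
  restricted x∈k = subst₂ _<_ (≡.sym (restrict-∈ f x∈k)) (≡.sym (restrict-∈ g x∈k))

∑∈-tight : ∀ {n} {k : Subset n} {f g : Fin n → ℕ} → (∀ x → x ∈ k → f x ≤ g x) →
           sumOver k g ≤ sumOver k f → ∀ x → x ∈ k → f x ≡ g x
∑∈-tight {k = k} {f} {g} f≤g ∑g≤∑f x x∈k = begin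
  f x             ≡⟨ restrict-∈ f x∈k ⟨
  restrict k f x  ≡⟨ ∑-tight (restrict-≤ f≤g) ∑g≤∑f x ⟩
  restrict k g x  ≡⟨ restrict-∈ g x∈k ⟩
  g x             ∎
  where open ≡-Reasoning

∑∈-+ : ∀ {n} (k : Subset n) (f g : Fin n → ℕ) →
       sumOver k (λ x → f x + g x) ≡ sumOver k f + sumOver k g
∑∈-+ k f g = trans (sum-cong-≗ split) (∑-distrib-+ (restrict k f) (restrict k g))
  where
  split : ∀ x → restrict k (λ y → f y + g y) x ≡ restrict k f x + restrict k g x
  split x with lookup k x
  ... | true = refl
  ... | false = refl

∑∈-const : ∀ {n} (c : ℕ) (k : Subset n) → sumOver k (λ _ → c) ≡ c ℕ.* ∣ k ∣
∑∈-const c [] = ≡.sym (*-zeroʳ c)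
∑∈-const c (true ∷ k) = trans (cong (λ t → c + t) (∑∈-const c k)) (≡.sym (*-suc c ∣ k ∣))
∑∈-const c (false ∷ k) = ∑∈-const c k

card : ∀ {n} (k : Subset n) → ∣ k ∣ ≡ sumOver k (λ _ → 1)
card k = ≡.sym (trans (∑∈-const 1 k) (*-identityˡ ∣ k ∣))

∑-split : ∀ {n} (k : Subset n) (f : Fin n → ℕ) → sum f ≡ sumOver k f + sumOver (∁ k) f
∑-split k f = trans (sum-cong-≗ split) (∑-distrib-+ (restrict k f) (restrict (∁ k) f))
  where
  split : ∀ x → f x ≡ restrict k f x + restrict (∁ k) f x
  split x rewrite lookup-map x not k with lookup k x
  ... | true = ≡.sym (+-identityʳ (f x))
  ... | false = refl

restrict≤ : ∀ {n} (k : Subset n) (f : Fin n → ℕ) x → restrict k f x ≤ f x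
restrict≤ k f x with lookup k x
... | true = ≤-refl
... | false = z≤n

∑∈≤∑ : ∀ {n} (k : Subset n) (f : Fin n → ℕ) → sumOver k f ≤ sum f
∑∈≤∑ k f = ∑-mono (restrict≤ k f)

∑∈≡∑⇒support⊆ : ∀ {n} {k : Subset n} {f : Fin n → ℕ} → sumOver k f ≡ sum f →
                ∀ {x} → 0 < f x → x ∈ k
∑∈≡∑⇒support⊆ {k = k} {f} total {x} 0<fx
  with lookup k x in k[x] | ∑-tight (restrict≤ k f) (≤-reflexive (≡.sym total)) x
... | true  | _ = lookup⇒[]= x k k[x]
... | false | 0≡fx = contradiction (≡.sym 0≡fx) (>⇒≢ 0<fx)

∑∈-comm : ∀ {n} (a b : Subset n) (f : Fin n → Fin n → ℕ) →
          sumOver a (λ x → sumOver b (f x)) ≡ sumOver b (λ y → sumOver a (λ x → f x y))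
∑∈-comm {n} a b f = begin
  sumOver a (λ x → sumOver b (f x))                   ≡⟨ sum-cong-≗ (λ x → if-sum (lookup a x) _) ⟩
  ∑[ x < n ] ∑[ y < n ] F x y                         ≡⟨ ∑-comm F ⟩
  ∑[ y < n ] ∑[ x < n ] F x y
    ≡⟨ sum-cong-≗ (λ y → sum-cong-≗ (λ x → if-swap (lookup a x) (lookup b y))) ⟩
  ∑[ y < n ] ∑[ x < n ] G y x                         ≡⟨ sum-cong-≗ (λ y → if-sum (lookup b y) _) ⟨
  sumOver b (λ y → sumOver a (λ x → f x y))           ∎
  where
  open ≡-Reasoning
  F : Fin n → Fin n → ℕ
  F x y = if lookup a x then restrict b (f x) y else 0
  G : Fin n → Fin n → ℕ
  G y x = if lookup b y then restrict a (λ x′ → f x′ y) x else 0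
  if-sum : ∀ c (h : Fin n → ℕ) → (if c then sum h else 0) ≡ ∑[ y < n ] (if c then h y else 0)
  if-sum true h = refl
  if-sum false h = ≡.sym (sum-replicate-zero n)
  if-swap : ∀ c d {m} → (if c then (if d then m else 0) else 0) ≡ (if d then (if c then m else 0) else 0)
  if-swap true d = refl
  if-swap false true = refl
  if-swap false false = refl

ind≤1 : ∀ b → ind b ≤ 1
ind≤1 true = ≤-refl
ind≤1 false = z≤n

ind<1 : ∀ {b} → b ≡ false → ind b < 1
ind<1 refl = s≤s z≤n

0<ind : ∀ {b} → b ≡ true → 0 < ind b
0<ind refl = s≤s z≤n

∣tabulate∣ : ∀ {n} (P : Fin n → Bool) → ∣ tabulate P ∣ ≡ sum (λ x → ind (P x))
∣tabulate∣ P = trans (card (tabulate P)) (sum-cong-≗ (λ x → cong ind (lookup∘tabulate P x)))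

x∈p─q⁻ : ∀ {n} (p q : Subset n) {x} → x ∈ p ─ q → x ∈ p × x ∉ q
x∈p─q⁻ (true ∷ p) (false ∷ q) here = here , λ ()
x∈p─q⁻ (false ∷ p) (false ∷ q) {zero} ()
x∈p─q⁻ (_ ∷ p) (_ ∷ q) (there x∈p─q) =
  Product.map there (λ x∉q → x∉q ∘ drop-there) (x∈p─q⁻ p q x∈p─q)

⊆⇒∩≡ : ∀ {n} {p q : Subset n} → p ⊆ q → p ∩ q ≡ p
⊆⇒∩≡ {p = p} {q} p⊆q = ⊆-antisym (p∩q⊆p p q) (λ x∈p → x∈p∩q⁺ (x∈p , p⊆q x∈p))

module _ {n : ℕ} (G : Graph n) where

  deg-∑ : ∀ x → deg G x ≡ sum (λ y → ind (adj G x y))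
  deg-∑ x = ∣tabulate∣ (adj G x)

  msum-∑ : ∀ k → msum G k ≡ ∑[ x ∈ k ] deg G x
  msum-∑ k = sum-tabulate (restrict k (deg G))

  ∈N⇒adj : ∀ {x y} → y ∈ N G x → adj G x y ≡ true
  ∈N⇒adj {x} {y} y∈Nx = trans (≡.sym (lookup∘tabulate (adj G x) y)) ([]=⇒lookup y∈Nx)

  degMinus-deg : ∀ v u → degMinus G v u + ind (adj G v u) ≡ deg G u
  degMinus-deg v u = begin
    degMinus G v u + ind (adj G v u)  ≡⟨ cong₂ _+_ (∣tabulate∣ P′) (cong ind (Graph.sym G v u)) ⟩
    sum f′ + f v                      ≡⟨ +-comm (sum f′) (f v) ⟩
    f v + sum f′                      ≡⟨ ∑-agree-off f′ f v same-off ⟨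
    f′ v + sum f                      ≡⟨ cong (λ t → t + sum f) f′-v ⟩
    sum f                             ≡⟨ deg-∑ u ⟨
    deg G u                           ∎
    where
    open ≡-Reasoning
    P′ : Fin n → Bool
    P′ w = adj G u w ∧ not ⌊ w ≟ v ⌋
    f f′ : Fin n → ℕ
    f w = ind (adj G u w)
    f′ w = ind (P′ w)
    same-off : ∀ w → w ≢ v → f′ w ≡ f w
    same-off w w≢v with w ≟ v
    ... | yes w≡v = contradiction w≡v w≢v
    ... | no _ = cong ind (∧-identityʳ (adj G u w))
    f′-v : f′ v ≡ 0
    f′-v with v ≟ v
    ... | yes _ = cong ind (∧-zeroʳ (adj G u v))
    ... | no v≢v = contradiction refl v≢v

  degMinus-nonadj : ∀ {v u} → adj G v u ≡ false → degMinus G v u ≡ deg G u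
  degMinus-nonadj {v} {u} vu =
    trans (≡.sym (+-identityʳ _)) (subst (λ b → degMinus G v u + ind b ≡ deg G u) vu (degMinus-deg v u))

  degMinus-adj : ∀ {v u} → adj G v u ≡ true → degMinus G v u + 1 ≡ deg G u
  degMinus-adj {v} {u} vu = subst (λ b → degMinus G v u + ind b ≡ deg G u) vu (degMinus-deg v u)

  -- If no non-neighbour u ≠ v and neighbour w of v satisfy d_u + 1 = d_w, then in G - v
  -- the non-neighbours and the neighbours of v never share a degree, so v is ds-completable.
  ds-completable-criterion : ∀ v →
    (∀ u w → u ≢ v → adj G v u ≡ false → adj G v w ≡ true → deg G u + 1 ≢ deg G w) →
    DsCompletable G v
  ds-completable-criterion v separated d
    with any? (λ u → ¬? (u ≟ v) ×-dec (degMinus G v u ℕ.≟ d) ×-dec (adj G v u Bool.≟ false))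
  ... | no no-non-neighbour =
    inj₁ λ u u≢v du → ¬-not λ vu → no-non-neighbour (u , u≢v , du , vu)
  ... | yes (u , u≢v , du , vu) = inj₂ λ w w≢v dw → ¬-not λ vw →
    separated u w u≢v vu vw (begin
      deg G u + 1         ≡⟨ cong (λ t → t + 1) (degMinus-nonadj vu) ⟨
      degMinus G v u + 1  ≡⟨ cong (λ t → t + 1) (trans du (≡.sym dw)) ⟩
      degMinus G v w + 1  ≡⟨ degMinus-adj vw ⟩
      deg G w             ∎)
    where open ≡-Reasoning

  ∉B⇒not-bad : ∀ {x} → x ∉ B G → ∀ u → deg G u + 1 ≢ deg G x
  ∉B⇒not-bad {x} x∉B u du+1≡dx = x∉B (lookup⇒[]= x (B G) x-bad)
    where
    x-bad : lookup (B G) x ≡ true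
    x-bad = trans (lookup∘tabulate _ x)
                  (trans (isYes≗does (any? _)) (dec-true (any? _) (u , du+1≡dx)))

  ∉degEq : ∀ {y c} → deg G y ≢ c → y ∉ degEq G c
  ∉degEq {y} {c} dy≢c y∈ = contradiction (trans (≡.sym ([]=⇒lookup y∈)) y-outside) λ ()
    where
    y-outside : lookup (degEq G c) y ≡ false
    y-outside = trans (lookup∘tabulate _ y)
                      (trans (isYes≗does _) (dec-false (deg G y ℕ.≟ c) dy≢c))

+-tight : ∀ {a b c d} → a ≤ b → c ≤ d → a + c ≡ b + d → a ≡ b × c ≡ d
+-tight {a} {b} {c} {d} a≤b c≤d a+c≡b+d with m≤n⇒m<n∨m≡n a≤b
... | inj₁ a<b = contradiction a+c≡b+d (<⇒≢ (+-mono-<-≤ a<b c≤d))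
... | inj₂ a≡b = a≡b , +-cancelˡ-≡ a c d (trans a+c≡b+d (cong (λ t → t + d) (≡.sym a≡b)))

-- Clearing the integer equation χ_ij = m_i when n = n_i + t.
balance : ∀ mj mi ni t nj →
          + mj ℤ.- ((+ (ni + t) ℤ.- + 1 ℤ.- + ni) * + nj) ≡ + mi → mj + nj ≡ mi + t ℕ.* nj
balance mj mi ni t nj χ≡mi = ℤ.+-injective (begin
  + (mj + nj)                                                  ≡⟨ ℤ.pos-+ mj nj ⟩
  + mj ℤ.+ + nj                                                ≡⟨ regroup (+ mj) (+ ni) (+ t) (+ nj) ⟩
  (+ mj ℤ.- ((+ ni ℤ.+ + t ℤ.- + 1 ℤ.- + ni) * + nj)) ℤ.+ + t * + nj
    ≡⟨ cong (λ m → (+ mj ℤ.- ((m ℤ.- + 1 ℤ.- + ni) * + nj)) ℤ.+ + t * + nj) (ℤ.pos-+ ni t) ⟨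
  (+ mj ℤ.- ((+ (ni + t) ℤ.- + 1 ℤ.- + ni) * + nj)) ℤ.+ + t * + nj
    ≡⟨ cong₂ ℤ._+_ χ≡mi (≡.sym (ℤ.pos-* t nj)) ⟩
  + mi ℤ.+ + (t ℕ.* nj)                                        ≡⟨ ℤ.pos-+ mi (t ℕ.* nj) ⟨
  + (mi + t ℕ.* nj)                                            ∎)
  where
  open ≡-Reasoning
  regroup : ∀ M A T N → M ℤ.+ N ≡ (M ℤ.- ((A ℤ.+ T ℤ.- + 1 ℤ.- A) * N)) ℤ.+ T * N
  regroup = solve-∀

μ-cases : ∀ {n} (G : Graph n) (i j : Subset n) → χ G i j * μ G i ≡ + msum G i →
          (Neighbourly G (∁ i) × χ G i j ≡ + msum G i) ⊎ msum G i ≡ 0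
μ-cases G i j χμ≡mi with neighbourly? G (∁ i)
... | yes nb = inj₁ (nb , trans (≡.sym (ℤ.*-identityʳ (χ G i j))) χμ≡mi)
... | no _ = inj₂ (ℤ.+-injective (trans (≡.sym χμ≡mi) (ℤ.*-zeroʳ (χ G i j))))

χ-balance : ∀ {n} (G : Graph n) (i j : Subset n) → χ G i j ≡ + msum G i →
            ∑[ y ∈ j ] deg G y + ∣ j ∣ ≡ ∑[ x ∈ i ] deg G x + ∣ ∁ i ∣ ℕ.* ∣ j ∣
χ-balance {n} G i j χ≡mi = begin
  ∑[ y ∈ j ] deg G y + ∣ j ∣              ≡⟨ cong (λ t → t + ∣ j ∣) (msum-∑ G j) ⟨
  msum G j + ∣ j ∣                        ≡⟨ balance (msum G j) (msum G i) (∣ i ∣) (∣ ∁ i ∣) (∣ j ∣) χ≡mi′ ⟩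
  msum G i + ∣ ∁ i ∣ ℕ.* ∣ j ∣            ≡⟨ cong (λ t → t + ∣ ∁ i ∣ ℕ.* ∣ j ∣) (msum-∑ G i) ⟩
  ∑[ x ∈ i ] deg G x + ∣ ∁ i ∣ ℕ.* ∣ j ∣  ∎
  where
  open ≡-Reasoning
  n≡ni+t : n ≡ ∣ i ∣ + ∣ ∁ i ∣
  n≡ni+t = ≡.sym (trans (cong (λ t → ∣ i ∣ + t) (∣∁p∣≡n∸∣p∣ i)) (m+[n∸m]≡n (∣p∣≤n i)))
  χ≡mi′ : + msum G j ℤ.- ((+ (∣ i ∣ + ∣ ∁ i ∣) ℤ.- + 1 ℤ.- + ∣ i ∣) * + ∣ j ∣) ≡ + msum G i
  χ≡mi′ = subst (λ m → + msum G j ℤ.- ((+ m ℤ.- + 1 ℤ.- + ∣ i ∣) * + ∣ j ∣) ≡ + msum G i) n≡ni+t χ≡mi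

module Between {n : ℕ} (G : Graph n) (i j : Subset n) (disjoint : ∀ {y} → y ∈ j → y ∉ i) where

  inside outside into-j : Fin n → ℕ
  inside y = ∑[ z ∈ i ] ind (adj G y z)
  outside y = ∑[ z ∈ ∁ i ] ind (adj G y z)
  into-j x = ∑[ y ∈ j ] ind (adj G x y)

  deg-split : ∀ y → deg G y ≡ inside y + outside y
  deg-split y = trans (deg-∑ G y) (∑-split i (λ z → ind (adj G y z)))

  into-j≤deg : ∀ x → into-j x ≤ deg G x
  into-j≤deg x = subst (into-j x ≤_) (≡.sym (deg-∑ G x)) (∑∈≤∑ j (λ y → ind (adj G x y)))

  -- A vertex is not its own neighbour, so y ∉ i has fewer than |∁ i| neighbours outside i.
  outside-bound : ∀ {y} → y ∉ i → suc (outside y) ≤ ∣ ∁ i ∣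
  outside-bound {y} y∉i = subst (suc (outside y) ≤_) (≡.sym (card (∁ i)))
    (∑∈-strict (λ z _ → ind≤1 (adj G y z)) (x∉p⇒x∈∁p y∉i) (ind<1 (irrefl G y)))

  double-count : ∑[ y ∈ j ] inside y ≡ ∑[ x ∈ i ] into-j x
  double-count = trans (∑∈-comm j i (λ y z → ind (adj G y z)))
                       (∑∈-cong i (λ z → ∑∈-cong j (λ y → cong ind (Graph.sym G y z))))

  decomposition : ∑[ x ∈ i ] into-j x + ∑[ y ∈ j ] suc (outside y) ≡ ∑[ y ∈ j ] deg G y + ∣ j ∣
  decomposition = begin
    ∑[ x ∈ i ] into-j x + ∑[ y ∈ j ] suc (outside y)
      ≡⟨ cong₂ _+_ (≡.sym double-count) (∑∈-+ j (λ _ → 1) outside) ⟩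
    ∑[ y ∈ j ] inside y + (∑[ y ∈ j ] 1 + ∑[ y ∈ j ] outside y)
      ≡⟨ cong (λ t → ∑[ y ∈ j ] inside y + t) (+-comm (∑[ y ∈ j ] 1) _) ⟩
    ∑[ y ∈ j ] inside y + (∑[ y ∈ j ] outside y + ∑[ y ∈ j ] 1)
      ≡⟨ +-assoc (∑[ y ∈ j ] inside y) _ _ ⟨
    ∑[ y ∈ j ] inside y + ∑[ y ∈ j ] outside y + ∑[ y ∈ j ] 1
      ≡⟨ cong₂ _+_ (≡.sym (trans (∑∈-cong j deg-split) (∑∈-+ j inside outside))) (≡.sym (card j)) ⟩
    ∑[ y ∈ j ] deg G y + ∣ j ∣
      ∎
    where open ≡-Reasoning

  -- When m_j + n_j = m_i + |∁ i| n_j, both estimates behind the decomposition are tight.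
  module Balanced (balanced : ∑[ y ∈ j ] deg G y + ∣ j ∣ ≡ ∑[ x ∈ i ] deg G x + ∣ ∁ i ∣ ℕ.* ∣ j ∣) where

    outside-bound-j : ∀ y → y ∈ j → suc (outside y) ≤ ∣ ∁ i ∣
    outside-bound-j y y∈j = outside-bound (disjoint y∈j)

    tight : ∑[ x ∈ i ] into-j x ≡ ∑[ x ∈ i ] deg G x × ∑[ y ∈ j ] suc (outside y) ≡ ∣ ∁ i ∣ ℕ.* ∣ j ∣
    tight = +-tight (∑∈-mono {k = i} (λ x _ → into-j≤deg x))
                    (subst (∑[ y ∈ j ] suc (outside y) ≤_) (∑∈-const ∣ ∁ i ∣ j)
                           (∑∈-mono {k = j} outside-bound-j))
                    (trans decomposition balanced)

    nbrs-in-j : ∀ {x y} → x ∈ i → adj G x y ≡ true → y ∈ j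
    nbrs-in-j {x} x∈i xy = ∑∈≡∑⇒support⊆ (trans into-j≡deg (deg-∑ G x)) (0<ind xy)
      where
      into-j≡deg : into-j x ≡ deg G x
      into-j≡deg = ∑∈-tight (λ x _ → into-j≤deg x) (≤-reflexive (≡.sym (proj₁ tight))) x x∈i

    -- Every vertex of j has exactly |∁ i| - 1 neighbours outside i ...
    outside-full : ∀ {y} → y ∈ j → suc (outside y) ≡ ∣ ∁ i ∣
    outside-full {y} y∈j =
      ∑∈-tight outside-bound-j (≤-reflexive (trans (∑∈-const ∣ ∁ i ∣ j) (≡.sym (proj₂ tight)))) y y∈j

    -- ... so it is adjacent to every other vertex outside i: a second non-neighbour
    -- there would lower that count.
    adjacent-outside : ∀ {y z} → y ∈ j → z ∉ i → z ≢ y → adj G y z ≡ true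
    adjacent-outside {y} {z} y∈j z∉i z≢y =
      ¬-not λ yz → 1+n≰n (subst (2 + outside y ≤_) ∣∁i∣≡ (two-missing yz))
      where
      ∣∁i∣≡ : ∑[ w ∈ ∁ i ] 1 ≡ suc (outside y)
      ∣∁i∣≡ = trans (≡.sym (card (∁ i))) (≡.sym (outside-full y∈j))
      two-missing : adj G y z ≡ false → 2 + outside y ≤ ∑[ w ∈ ∁ i ] 1
      two-missing yz =
        ∑∈-strict₂ (λ w _ → ind≤1 (adj G y w)) (x∉p⇒x∈∁p (disjoint y∈j)) (x∉p⇒x∈∁p z∉i)
                   (z≢y ∘ ≡.sym) (ind<1 (irrefl G y)) (ind<1 yz)

    unique-inside : ∀ {y x u} → y ∈ j → deg G y ≡ ∣ ∁ i ∣ → x ∈ i → u ∈ i →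
                    adj G y x ≡ true → adj G y u ≡ true → x ≡ u
    unique-inside {y} {x} {u} y∈j dy x∈i u∈i yx yu with x ≟ u
    ... | yes x≡u = x≡u
    ... | no x≢u = contradiction (subst (2 ≤_) one-inside two-inside) (1+n≰n {1})
      where
      one-inside : inside y ≡ 1
      one-inside = +-cancelʳ-≡ (outside y) (inside y) 1
                     (trans (≡.sym (deg-split y)) (trans dy (≡.sym (outside-full y∈j))))
      two-inside : 2 ≤ inside y
      two-inside = ≤-trans (m≤m+n 2 _) (∑∈-strict₂ (λ _ _ → z≤n) x∈i u∈i x≢u (0<ind yx) (0<ind yu))

    ds-completable : Neighbourly G (∁ i) → ∀ {x y} → x ∈ i → x ∉ B G → adj G x y ≡ true →
                     y ∈ j → deg G y ≡ ∣ ∁ i ∣ → DsCompletable G y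
    ds-completable nb {x} {y} x∈i x∉B xy y∈j dy = ds-completable-criterion G y separated
      where
      separated : ∀ u w → u ≢ y → adj G y u ≡ false → adj G y w ≡ true → deg G u + 1 ≢ deg G w
      separated u w u≢y yu yw du+1≡dw with u ∈? i | w ∈? i
      ... | no u∉i | _ = contradiction (trans (≡.sym yu) (adjacent-outside y∈j u∉i u≢y)) λ ()
      ... | yes u∈i | no w∉i = nb u w (x∈p⇒x∉∁p u∈i) (x∉p⇒x∈∁p w∉i) du+1≡dw
      ... | yes u∈i | yes w∈i =
        ∉B⇒not-bad G x∉B u (subst (λ v → deg G u + 1 ≡ deg G v) (≡.sym x≡w) du+1≡dw)
        where
        x≡w : x ≡ w
        x≡w = unique-inside y∈j dy x∈i w∈i (trans (Graph.sym G y x) xy) yw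

neighbours-of-good : ∀ {n} (G : Graph n) → (∀ v → ¬ DsCompletable G v) →
  (i j : Subset n) → (∀ {y} → y ∈ j → y ∉ i) → χ G i j * μ G i ≡ + msum G i →
  ∀ {x y} → x ∈ i → x ∉ B G → adj G x y ≡ true → y ∈ j × deg G y ≢ ∣ ∁ i ∣
neighbours-of-good G no-ds i j disjoint χμ≡mi {x} {y} x∈i x∉B xy with μ-cases G i j χμ≡mi
... | inj₁ (nb , χ≡mi) = y∈j , λ dy → no-ds y (ds-completable nb x∈i x∉B xy y∈j dy)
  where
  open Between G i j disjoint
  open Balanced (χ-balance G i j χ≡mi)
  y∈j : y ∈ j
  y∈j = nbrs-in-j x∈i xy
... | inj₂ mi≡0 = contradiction (trans (≡.sym (cong ind xy)) isolated) λ ()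
  where
  dx≡0 : deg G x ≡ 0
  dx≡0 = trans (≡.sym (restrict-∈ (deg G) x∈i)) (∑≡0⇒0 (trans (≡.sym (msum-∑ G i)) mi≡0) x)
  isolated : ind (adj G x y) ≡ 0
  isolated = ∑≡0⇒0 (trans (≡.sym (deg-∑ G x)) dx≡0) y

lemma9 : {n : ℕ} (G : Graph n)
    → (∀ v → ¬ DsCompletable G v)
    → (i j : Subset n)
    → i ∩ j ≡ ⊥
    → χ G i j * μ G i ≡ + msum G i
    → ε G (i ─ B G) (j ─ degEq G (n ∸ ∣ i ∣)) ≡ msum G (i ─ B G)
lemma9 {n} G no-ds i j i∩j≡⊥ χμ≡mi = cong Vec.sum (tabulate-cong summand)
  where
  g s : Subset n
  g = i ─ B G
  s = j ─ degEq G (n ∸ ∣ i ∣)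

  disjoint : ∀ {y} → y ∈ j → y ∉ i
  disjoint y∈j y∈i = ∉⊥ (subst (_ ∈_) i∩j≡⊥ (x∈p∩q⁺ (y∈i , y∈j)))

  N⊆s : ∀ {x} → x ∈ g → N G x ⊆ s
  N⊆s {x} x∈g {y} y∈Nx with x∈p─q⁻ i (B G) x∈g
  ... | x∈i , x∉B with neighbours-of-good G no-ds i j disjoint χμ≡mi x∈i x∉B (∈N⇒adj G y∈Nx)
  ...   | y∈j , dy≢t = x∈p∧x∉q⇒x∈p─q y∈j (∉degEq G (subst (deg G y ≢_) (∣∁p∣≡n∸∣p∣ i) dy≢t))

  summand : ∀ x → (if lookup g x then ∣ N G x ∩ s ∣ else 0) ≡ (if lookup g x then deg G x else 0)
  summand x with lookup g x in g[x]
  ... | true = cong ∣_∣ (⊆⇒∩≡ (N⊆s (lookup⇒[]= x g g[x])))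
  ... | false = refl
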